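{- Let $A[1..n]$ be a nonempty array containing a permutation of $\{1,\dots,n\}$, and let $T=\big(\bigodot_{i=1}^{n} 0^{A[i]}1^{i}\big)\cdot 0^{n+1}1^{n+1}\in\{0,1\}^*$. Then for every $v\in[1..n]$ and every $r\in[1..\mathrm{count}_A(n,v)]$, it holds $\mathrm{select}_A(r,v)=\mathrm{LCP}_T[b+r+1]-v$, where $b=|\{j\in[1..|T|]: T[j..|T|]\prec 0^v1\}|$.
   Context: $\bigodot$ denotes concatenation, $c^k$ is $k$ copies of symbol $c$, and $0\prec 1$. Lexicographic order: a proper prefix is smaller; otherwise compare at the first differing position. For an array $A[1..m]$ of nonnegative integers, $\mathrm{count}_A(j,v)=|\{i\in(0..j]: A[i]\ge v\}|$, and for $r\in[1..\mathrm{count}_A(m,v)]$, $\mathrm{select}_A(r,v)$ is the $r$-th smallest element of $\{i\in[1..m]:A[i]\ge v\}$. $\mathrm{SA}_T$ lists the starting positions of suffixes of $T$ in increasing lexicographic order; $\mathrm{LCP}_T[1]=0$ and $\mathrm{LCP}_T[i]$ (for $i\ge2$) is the length of the longest common prefix of the suffixes starting at $\mathrm{SA}_T[i]$ and $\mathrm{SA}_T[i-1]$. -}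

module Defs where

open import Data.Bool using (Bool; true; false; _∧_; not)
open import Data.Nat using (ℕ; zero; suc; _+_; _∸_; _≤ᵇ_; _≡ᵇ_)
open import Data.List using (List; []; _∷_; _++_; length; drop; replicate; upTo; map; filterᵇ; concat; zip)

-- Binary strings: false = symbol 0, true = symbol 1 (so 0 ≺ 1).
Str : Set
Str = List Bool

lexLt : Str → Str → Bool
lexLt []       []       = false
lexLt []       (_ ∷ _)  = true
lexLt (_ ∷ _)  []       = false
lexLt (false ∷ xs) (false ∷ ys) = lexLt xs ys
lexLt (true  ∷ xs) (true  ∷ ys) = lexLt xs ys
lexLt (false ∷ _)  (true  ∷ _)  = true
lexLt (true  ∷ _)  (false ∷ _)  = false

range1 : ℕ → List ℕ
range1 m = map suc (upTo m)

-- 1-indexed array access (default 0 outside [1..|A|])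
at : List ℕ → ℕ → ℕ
at []       _             = 0
at (x ∷ _)  zero          = 0
at (x ∷ _)  (suc zero)    = x
at (_ ∷ xs) (suc (suc i)) = at xs (suc i)

count : List ℕ → ℕ → ℕ → ℕ
count A j v = length (filterᵇ (λ i → v ≤ᵇ at A i) (range1 j))

select : List ℕ → ℕ → ℕ → ℕ
select A r v = at (filterᵇ (λ i → v ≤ᵇ at A i) (range1 (length A))) r

suffix : Str → ℕ → Str
suffix T j = drop (j ∸ 1) T

rankSuf : Str → ℕ → ℕ
rankSuf T p = length (filterᵇ (λ q → lexLt (suffix T q) (suffix T p)) (range1 (length T)))

firstOr0 : List ℕ → ℕ
firstOr0 []      = 0
firstOr0 (x ∷ _) = x

-- SA_T[i] (1-indexed): the starting position whose suffix has exactly i-1 smaller suffixes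
-- (suffixes of T are pairwise distinct, so this is the i-th suffix in lexicographic order).
SA : Str → ℕ → ℕ
SA T i = firstOr0 (filterᵇ (λ p → rankSuf T p ≡ᵇ (i ∸ 1)) (range1 (length T)))

lcp : Str → Str → ℕ
lcp (false ∷ xs) (false ∷ ys) = suc (lcp xs ys)
lcp (true  ∷ xs) (true  ∷ ys) = suc (lcp xs ys)
lcp _ _ = 0

LCP : Str → ℕ → ℕ
LCP T zero = 0
LCP T (suc zero) = 0
LCP T (suc (suc k)) = lcp (suffix T (SA T (suc (suc k)))) (suffix T (SA T (suc k)))

buildT : List ℕ → Str
buildT A = concat (map (λ i → replicate (at A i) false ++ replicate i true) (range1 n))
           ++ (replicate (suc n) false ++ replicate (suc n) true)
  where n = length A

bOf : Str → ℕ → ℕ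
bOf T v = length (filterᵇ (λ j → lexLt (suffix T j) (replicate v false ++ (true ∷ []))) (range1 (length T)))

{-# OPTIONS --safe #-}
-- A suffix of T extending 0^v 1 starts exactly v symbols before the end of a zero run of length
-- at least v, so it reads 0^v 1^i R where i is the index of a block with A[i] ≥ v (or i = n + 1
-- for the final run 0^(n+1) 1^(n+1)) and R is empty or begins with 0. Such suffixes are ordered
-- by i, and two of them with i < j share exactly v + i leading symbols. A suffix is smaller than
-- 0^v 1^i R iff it is smaller than 0^v 1, or it extends 0^v 1 and has a smaller index; hence these
-- suffixes occupy SA positions b + 1, b + 2, ... in the order of their indices, and
-- LCP[b + r + 1] compares the suffixes of the r-th and (r+1)-th indices, giving v + select_A(r, v).
module Submission where

open import Defs
open import Data.Bool using (Bool; true; false; T; _∧_; _∨_)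
open import Data.Bool.Properties using (T-∧)
open import Data.Empty using (⊥; ⊥-elim)
open import Data.Unit using (⊤; tt)
open import Data.Nat using (ℕ; zero; suc; _+_; _∸_; _≤_; _<_; z≤n; s≤s; _≤ᵇ_; _≡ᵇ_)
open import Data.Nat.Properties using (+-suc; +-comm; <-irrefl; >⇒≢; <⇒≤; ≤-pred; n<1+n; ≡ᵇ⇒≡; ≡⇒≡ᵇ; ≤ᵇ-reflects-≤; ≰⇒>; ≤⇒≤ᵇ; m≤n⇒m<n∨m≡n; m≤n⇒m≤1+n; m≤n⇒m⊓n≡m; m+n∸m≡n)
open import Data.List using (List; []; _∷_; _++_; _∷ʳ_; length; replicate; map; filter; filterᵇ; drop; take; upTo; applyUpTo; concat)
open import Data.List.Properties using (++-assoc; ++-identityʳ; length-++; length-map; length-take; length-replicate; map-++; map-∘; map-id; map-applyUpTo; concat-++; filter-++; filter-accept; filter-reject; filter-none)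
open import Data.List.Membership.Propositional using (_∈_)
open import Data.List.Membership.Propositional.Properties using (∈-++⁺ʳ; ∈-map⁺; ∈-map⁻; ∈-filter⁺; ∈-filter⁻)
open import Data.List.Relation.Unary.Any using (here; there)
open import Data.List.Relation.Unary.All as All using (All; []; _∷_)
import Data.List.Relation.Unary.All.Properties as Allₚ
open import Data.List.Relation.Unary.AllPairs as AllPairs using (AllPairs; []; _∷_)
import Data.List.Relation.Unary.AllPairs.Properties as AllPairsₚ
open import Data.List.Relation.Binary.Pointwise using (Pointwise; []; _∷_; Pointwise-length)
open import Data.List.Relation.Binary.Permutation.Propositional using (_↭_)
open import Data.List.Relation.Binary.Permutation.Propositional.Properties using (∈-resp-↭)
open import Data.Product using (Σ; ∃₂; _×_; _,_; proj₁; proj₂; uncurry)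
open import Data.Sum using (_⊎_; inj₁; inj₂)
open import Function using (_∘_; id)
open import Function.Bundles using (Equivalence)
open import Relation.Nullary using (¬_; Dec)
open import Relation.Nullary.Decidable using (T?)
open import Relation.Nullary.Reflects using (ofʸ; ofⁿ)
open import Relation.Binary.PropositionalEquality using (_≡_; refl; sym; trans; cong; cong₂; subst; subst₂; module ≡-Reasoning)

module _ {A : Set} where

  filterᵇ-map : ∀ {B : Set} (p : B → Bool) (f : A → B) xs →
    filterᵇ p (map f xs) ≡ map f (filterᵇ (p ∘ f) xs)
  filterᵇ-map p f []       = refl
  filterᵇ-map p f (x ∷ xs) with p (f x)
  ... | true  = cong (f x ∷_) (filterᵇ-map p f xs)
  ... | false = filterᵇ-map p f xs

  filterᵇ-filterᵇ : ∀ (p q : A → Bool) xs →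
    filterᵇ q (filterᵇ p xs) ≡ filterᵇ (λ x → p x ∧ q x) xs
  filterᵇ-filterᵇ p q []       = refl
  filterᵇ-filterᵇ p q (x ∷ xs) with p x
  ... | false = filterᵇ-filterᵇ p q xs
  ... | true with q x
  ...   | true  = cong (x ∷_) (filterᵇ-filterᵇ p q xs)
  ...   | false = filterᵇ-filterᵇ p q xs

  filterᵇ-cong : ∀ {p q : A → Bool} → (∀ x → p x ≡ q x) → ∀ xs → filterᵇ p xs ≡ filterᵇ q xs
  filterᵇ-cong p≗q []       = refl
  filterᵇ-cong {p} {q} p≗q (x ∷ xs) with p x | q x | p≗q x
  ... | true  | true  | refl = cong (x ∷_) (filterᵇ-cong p≗q xs)
  ... | false | false | refl = filterᵇ-cong p≗q xs

  length-filterᵇ-∨ : ∀ (p q : A → Bool) → (∀ x → T (p x) → ¬ T (q x)) → ∀ xs →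
    length (filterᵇ (λ x → p x ∨ q x) xs) ≡ length (filterᵇ p xs) + length (filterᵇ q xs)
  length-filterᵇ-∨ p q disjoint []       = refl
  length-filterᵇ-∨ p q disjoint (x ∷ xs) with p x | q x | disjoint x
  ... | true  | true  | p∧q⇒⊥ = ⊥-elim (p∧q⇒⊥ tt tt)
  ... | true  | false | _ = cong suc (length-filterᵇ-∨ p q disjoint xs)
  ... | false | true  | _ = trans (cong suc (length-filterᵇ-∨ p q disjoint xs)) (sym (+-suc _ _))
  ... | false | false | _ = length-filterᵇ-∨ p q disjoint xs

  module _ {p q : A → Bool} (p⇒q : ∀ x → T (p x) → T (q x)) where

    length-filterᵇ-mono : ∀ xs → length (filterᵇ p xs) ≤ length (filterᵇ q xs)
    length-filterᵇ-mono []       = z≤n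
    length-filterᵇ-mono (x ∷ xs) with p x | q x | p⇒q x
    ... | true  | true  | _     = s≤s (length-filterᵇ-mono xs)
    ... | true  | false | px⇒qx = ⊥-elim (px⇒qx tt)
    ... | false | true  | _     = m≤n⇒m≤1+n (length-filterᵇ-mono xs)
    ... | false | false | _     = length-filterᵇ-mono xs

    length-filterᵇ-mono-< : ∀ {y} xs → y ∈ xs → ¬ T (p y) → T (q y) →
      length (filterᵇ p xs) < length (filterᵇ q xs)
    length-filterᵇ-mono-< (x ∷ xs) (here refl) ¬py qy with p x | q x
    ... | true  | _     = ⊥-elim (¬py tt)
    ... | false | true  = s≤s (length-filterᵇ-mono xs)
    ... | false | false = ⊥-elim qy
    length-filterᵇ-mono-< (x ∷ xs) (there y∈xs) ¬py qy with p x | q x | p⇒q x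
    ... | true  | true  | _     = s≤s (length-filterᵇ-mono-< xs y∈xs ¬py qy)
    ... | true  | false | px⇒qx = ⊥-elim (px⇒qx tt)
    ... | false | true  | _     = m≤n⇒m≤1+n (length-filterᵇ-mono-< xs y∈xs ¬py qy)
    ... | false | false | _     = length-filterᵇ-mono-< xs y∈xs ¬py qy

AllPairs-++⁻ʳ : ∀ {A : Set} {R : A → A → Set} xs {ys} → AllPairs R (xs ++ ys) → AllPairs R ys
AllPairs-++⁻ʳ []       rs       = rs
AllPairs-++⁻ʳ (_ ∷ xs) (_ ∷ rs) = AllPairs-++⁻ʳ xs rs

module _ {A B : Set} {R : A → B → Set} where

  Pointwise-++⁻ : ∀ is₁ {is₂ xs} → Pointwise R (is₁ ++ is₂) xs →
    ∃₂ λ xs₁ xs₂ → xs ≡ xs₁ ++ xs₂ × Pointwise R is₁ xs₁ × Pointwise R is₂ xs₂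
  Pointwise-++⁻ []        rs       = [] , _ , refl , [] , rs
  Pointwise-++⁻ (_ ∷ is₁) (r ∷ rs) with xs₁ , xs₂ , refl , rs₁ , rs₂ ← Pointwise-++⁻ is₁ rs =
    _ ∷ xs₁ , xs₂ , refl , r ∷ rs₁ , rs₂

  module _ {S : A → A → Set} {S′ : B → B → Set}
           (transport : ∀ {i j x y} → R i x → R j y → S i j → S′ x y) where

    All-Pointwise : ∀ {i x is xs} → R i x → Pointwise R is xs → All (S i) is → All (S′ x) xs
    All-Pointwise r []        []       = []
    All-Pointwise r (r′ ∷ rs) (s ∷ ss) = transport r r′ s ∷ All-Pointwise r rs ss

    AllPairs-Pointwise : ∀ {is xs} → Pointwise R is xs → AllPairs S is → AllPairs S′ xs
    AllPairs-Pointwise []       []       = []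
    AllPairs-Pointwise (r ∷ rs) (s ∷ ss) = All-Pointwise r rs s ∷ AllPairs-Pointwise rs ss

at-∈ : ∀ A {i} → 1 ≤ i → i ≤ length A → at A i ∈ A
at-∈ (x ∷ A) {suc zero}    _ _         = here refl
at-∈ (x ∷ A) {suc (suc i)} _ (s≤s i≤n) = there (at-∈ A (s≤s z≤n) i≤n)

at-++ˡ : ∀ xs ys r → r < length xs → at (xs ++ ys) (suc r) ≡ at xs (suc r)
at-++ˡ (x ∷ xs) ys zero    _        = refl
at-++ˡ (x ∷ xs) ys (suc r) (s≤s r<) = at-++ˡ xs ys r r<

at-split₂ : ∀ xs r → suc r < length xs →
  xs ≡ take r xs ++ at xs (suc r) ∷ at xs (suc (suc r)) ∷ drop (suc (suc r)) xs
at-split₂ (x ∷ y ∷ xs) zero    _        = refl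
at-split₂ (x ∷ xs)     (suc r) (s≤s r<) = cong (x ∷_) (at-split₂ xs r r<)

firstOr0-∈ : ∀ {y ys} → y ∈ ys → firstOr0 ys ∈ ys
firstOr0-∈ (here refl) = here refl
firstOr0-∈ (there _)   = here refl

range1-bounds : ∀ n → All (λ i → 1 ≤ i × i ≤ n) (range1 n)
range1-bounds n = Allₚ.map⁺ (Allₚ.applyUpTo⁺₁ id n (λ i<n → s≤s z≤n , i<n))

range1-increasing : ∀ n → AllPairs _<_ (range1 n)
range1-increasing n = AllPairsₚ.map⁺ (AllPairs.map s≤s (AllPairsₚ.applyUpTo⁺₁ id n (λ i<j _ → i<j)))

-- Lexicographic order

infix 4 _≺_

_≺_ : Str → Str → Set
x ≺ y = T (lexLt x y)

_≺?_ : ∀ x y → Dec (x ≺ y)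
x ≺? y = T? (lexLt x y)

≺-irrefl : ∀ x → ¬ x ≺ x
≺-irrefl []          ()
≺-irrefl (false ∷ x) = ≺-irrefl x
≺-irrefl (true ∷ x)  = ≺-irrefl x

≺-trans : ∀ x y z → x ≺ y → y ≺ z → x ≺ z
≺-trans []          (_ ∷ _)     (_ ∷ _)     _ _  = tt
≺-trans (false ∷ x) (false ∷ y) (false ∷ z) p q  = ≺-trans x y z p q
≺-trans (false ∷ _) (false ∷ _) (true ∷ _)  _ _  = tt
≺-trans (false ∷ _) (true ∷ _)  (true ∷ _)  _ _  = tt
≺-trans (true ∷ x)  (true ∷ y)  (true ∷ z)  p q  = ≺-trans x y z p q
≺-trans (_ ∷ _)     (_ ∷ _)     []          _ ()
≺-trans (false ∷ _) (true ∷ _)  (false ∷ _) _ ()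
≺-trans (true ∷ _)  (true ∷ _)  (false ∷ _) _ ()
≺-trans (true ∷ _)  (false ∷ _) _           () _

≺-asym : ∀ x y → x ≺ y → ¬ y ≺ x
≺-asym x y x≺y y≺x = ≺-irrefl x (≺-trans x y x x≺y y≺x)

≺-trichotomy : ∀ x y → x ≡ y ⊎ x ≺ y ⊎ y ≺ x
≺-trichotomy []          []          = inj₁ refl
≺-trichotomy []          (_ ∷ _)     = inj₂ (inj₁ tt)
≺-trichotomy (_ ∷ _)     []          = inj₂ (inj₂ tt)
≺-trichotomy (false ∷ _) (true ∷ _)  = inj₂ (inj₁ tt)
≺-trichotomy (true ∷ _)  (false ∷ _) = inj₂ (inj₂ tt)
≺-trichotomy (false ∷ x) (false ∷ y) with ≺-trichotomy x y
... | inj₁ refl = inj₁ refl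
... | inj₂ x≶y  = inj₂ x≶y
≺-trichotomy (true ∷ x)  (true ∷ y)  with ≺-trichotomy x y
... | inj₁ refl = inj₁ refl
... | inj₂ x≶y  = inj₂ x≶y

lexLt-++ˡ : ∀ u x y → lexLt (u ++ x) (u ++ y) ≡ lexLt x y
lexLt-++ˡ []          x y = refl
lexLt-++ˡ (false ∷ u) x y = lexLt-++ˡ u x y
lexLt-++ˡ (true ∷ u)  x y = lexLt-++ˡ u x y

lcp-++ˡ : ∀ u x y → lcp (u ++ x) (u ++ y) ≡ length u + lcp x y
lcp-++ˡ []          x y = refl
lcp-++ˡ (false ∷ u) x y = cong suc (lcp-++ˡ u x y)
lcp-++ˡ (true ∷ u)  x y = cong suc (lcp-++ˡ u x y)

isPrefixOf : Str → Str → Bool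
isPrefixOf []          _           = true
isPrefixOf (_ ∷ _)     []          = false
isPrefixOf (false ∷ u) (false ∷ x) = isPrefixOf u x
isPrefixOf (true ∷ u)  (true ∷ x)  = isPrefixOf u x
isPrefixOf (false ∷ _) (true ∷ _)  = false
isPrefixOf (true ∷ _)  (false ∷ _) = false

lexLt-prefix : ∀ w s x → T (isPrefixOf w s) → lexLt x s ≡ lexLt x w ∨ (isPrefixOf w x ∧ lexLt x s)
lexLt-prefix []          s           []          _ = refl
lexLt-prefix []          s           (_ ∷ _)     _ = refl
lexLt-prefix (false ∷ w) (false ∷ s) []          _ = refl
lexLt-prefix (false ∷ w) (false ∷ s) (false ∷ x) p = lexLt-prefix w s x p
lexLt-prefix (false ∷ w) (false ∷ s) (true ∷ x)  _ = refl
lexLt-prefix (true ∷ w)  (true ∷ s)  []          _ = refl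
lexLt-prefix (true ∷ w)  (true ∷ s)  (false ∷ x) _ = refl
lexLt-prefix (true ∷ w)  (true ∷ s)  (true ∷ x)  p = lexLt-prefix w s x p

extending : Str → List Str → List Str
extending w = filterᵇ (isPrefixOf w)

≺⇒¬isPrefixOf : ∀ x w → x ≺ w → ¬ T (isPrefixOf w x)
≺⇒¬isPrefixOf []          []          ()
≺⇒¬isPrefixOf (_ ∷ _)     []          ()
≺⇒¬isPrefixOf (false ∷ x) (false ∷ w) = ≺⇒¬isPrefixOf x w
≺⇒¬isPrefixOf (true ∷ x)  (true ∷ w)  = ≺⇒¬isPrefixOf x w

zeros ones : ℕ → Str
zeros n = replicate n false
ones n = replicate n true

NoLeadingOne : Str → Set
NoLeadingOne (true ∷ _) = ⊥
NoLeadingOne _          = ⊤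

ones-≺ : ∀ {i j R R′} → i < j → NoLeadingOne R → ones i ++ R ≺ ones j ++ R′
ones-≺ {zero}  {R = []}        (s≤s _)   _ = tt
ones-≺ {zero}  {R = false ∷ _} (s≤s _)   _ = tt
ones-≺ {suc i}                 (s≤s i<j) R = ones-≺ {i} i<j R

lcp-ones : ∀ {i j R R′} → i < j → NoLeadingOne R → lcp (ones j ++ R′) (ones i ++ R) ≡ i
lcp-ones {zero}  {R = []}        (s≤s _)   _ = refl
lcp-ones {zero}  {R = false ∷ _} (s≤s _)   _ = refl
lcp-ones {suc i} {suc j}         (s≤s i<j) R = cong suc (lcp-ones i<j R)

-- Ranks of suffixes and the suffix array

countBelow : Str → List Str → ℕ
countBelow s xs = length (filterᵇ (λ x → lexLt x s) xs)

countBelow-prefix : ∀ w s → T (isPrefixOf w s) → ∀ xs →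
  countBelow s xs ≡ countBelow w xs + countBelow s (extending w xs)
countBelow-prefix w s w⊑s xs = begin
    countBelow s xs
  ≡⟨ cong length (filterᵇ-cong (λ x → lexLt-prefix w s x w⊑s) xs) ⟩
    length (filterᵇ (λ x → lexLt x w ∨ (isPrefixOf w x ∧ lexLt x s)) xs)
  ≡⟨ length-filterᵇ-∨ _ _ (λ x x≺w → ≺⇒¬isPrefixOf x w x≺w ∘ proj₁ ∘ Equivalence.to T-∧) xs ⟩
    countBelow w xs + length (filterᵇ (λ x → isPrefixOf w x ∧ lexLt x s) xs)
  ≡⟨ cong (λ ys → countBelow w xs + length ys) (sym (filterᵇ-filterᵇ (isPrefixOf w) _ xs)) ⟩
    countBelow w xs + countBelow s (extending w xs)
  ∎
  where open ≡-Reasoning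

countBelow-sorted : ∀ pre {x post} → AllPairs _≺_ (pre ++ x ∷ post) →
  countBelow x (pre ++ x ∷ post) ≡ length pre
countBelow-sorted [] {x} {post} (x≺post ∷ _) = begin
    countBelow x (x ∷ post)
  ≡⟨ cong length (filter-reject (_≺? x) {x} {post} (≺-irrefl x)) ⟩
    countBelow x post
  ≡⟨ cong length (filter-none (_≺? x) (All.map (≺-asym x _) x≺post)) ⟩
    0
  ∎
  where open ≡-Reasoning
countBelow-sorted (y ∷ pre) {x} {post} (y≺rest ∷ sorted) =
  trans (cong length (filter-accept (_≺? x) {y} {pre ++ x ∷ post} y≺x))
        (cong suc (countBelow-sorted pre sorted))
  where y≺x = All.lookup y≺rest (∈-++⁺ʳ pre (here refl))

countBelow-≺ : ∀ {x y} xs → x ≺ y → x ∈ xs → countBelow x xs < countBelow y xs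
countBelow-≺ {x} {y} xs x≺y x∈xs =
  length-filterᵇ-mono-< (λ z z≺x → ≺-trans z x y z≺x x≺y) xs x∈xs (≺-irrefl x) x≺y

countBelow-injective : ∀ {x y} xs → x ∈ xs → y ∈ xs → countBelow x xs ≡ countBelow y xs → x ≡ y
countBelow-injective {x} {y} xs x∈xs y∈xs eq with ≺-trichotomy x y
... | inj₁ x≡y        = x≡y
... | inj₂ (inj₁ x≺y) = ⊥-elim (<-irrefl eq (countBelow-≺ xs x≺y x∈xs))
... | inj₂ (inj₂ y≺x) = ⊥-elim (<-irrefl (sym eq) (countBelow-≺ xs y≺x y∈xs))

countBelow-prefixed : ∀ w xs ys₁ {y ys₂} → AllPairs _≺_ (extending w xs) →
  extending w xs ≡ ys₁ ++ y ∷ ys₂ →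
  y ∈ xs × countBelow y xs ≡ countBelow w xs + length ys₁
countBelow-prefixed w xs ys₁ {y} {ys₂} sorted ys≡ = y∈xs , (begin
    countBelow y xs
  ≡⟨ countBelow-prefix w y w⊑y xs ⟩
    countBelow w xs + countBelow y (extending w xs)
  ≡⟨ cong (λ ys → countBelow w xs + countBelow y ys) ys≡ ⟩
    countBelow w xs + countBelow y (ys₁ ++ y ∷ ys₂)
  ≡⟨ cong (countBelow w xs +_) (countBelow-sorted ys₁ (subst (AllPairs _≺_) ys≡ sorted)) ⟩
    countBelow w xs + length ys₁
  ∎)
  where
  open ≡-Reasoning
  y∈ys : y ∈ filter (T? ∘ isPrefixOf w) xs
  y∈ys = subst (y ∈_) (sym ys≡) (∈-++⁺ʳ ys₁ (here refl))
  y∈xs = proj₁ (∈-filter⁻ (T? ∘ isPrefixOf w) {xs = xs} y∈ys)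
  w⊑y = proj₂ (∈-filter⁻ (T? ∘ isPrefixOf w) {xs = xs} y∈ys)

suffixes : Str → List Str
suffixes []      = []
suffixes (c ∷ t) = (c ∷ t) ∷ suffixes t

suffixes-++ : ∀ t u → suffixes (t ++ u) ≡ map (_++ u) (suffixes t) ++ suffixes u
suffixes-++ []      u = refl
suffixes-++ (c ∷ t) u = cong ((c ∷ t ++ u) ∷_) (suffixes-++ t u)

applyUpTo-drop : ∀ t → applyUpTo (λ i → drop i t) (length t) ≡ suffixes t
applyUpTo-drop []      = refl
applyUpTo-drop (c ∷ t) = cong ((c ∷ t) ∷_) (applyUpTo-drop t)

map-suffix-range1 : ∀ t → map (suffix t) (range1 (length t)) ≡ suffixes t
map-suffix-range1 t = begin
    map (suffix t) (map suc (upTo (length t)))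
  ≡⟨ cong (map (suffix t)) (map-applyUpTo id suc (length t)) ⟩
    map (suffix t) (applyUpTo suc (length t))
  ≡⟨ map-applyUpTo suc (suffix t) (length t) ⟩
    applyUpTo (λ i → drop i t) (length t)
  ≡⟨ applyUpTo-drop t ⟩
    suffixes t
  ∎
  where open ≡-Reasoning

suffix-∈ : ∀ t {p} → p ∈ range1 (length t) → suffix t p ∈ suffixes t
suffix-∈ t {p} p∈ = subst (suffix t p ∈_) (map-suffix-range1 t) (∈-map⁺ (suffix t) p∈)

countBelow-suffixes : ∀ t s →
  length (filterᵇ (λ q → lexLt (suffix t q) s) (range1 (length t))) ≡ countBelow s (suffixes t)
countBelow-suffixes t s = begin
    length (filterᵇ ((λ x → lexLt x s) ∘ suffix t) positions)
  ≡⟨ sym (length-map (suffix t) (filterᵇ _ positions)) ⟩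
    length (map (suffix t) (filterᵇ ((λ x → lexLt x s) ∘ suffix t) positions))
  ≡⟨ cong length (sym (filterᵇ-map (λ x → lexLt x s) (suffix t) positions)) ⟩
    countBelow s (map (suffix t) positions)
  ≡⟨ cong (countBelow s) (map-suffix-range1 t) ⟩
    countBelow s (suffixes t)
  ∎
  where
  open ≡-Reasoning
  positions = range1 (length t)

SA-countBelow : ∀ t {x} k → x ∈ suffixes t → countBelow x (suffixes t) ≡ k →
  suffix t (SA t (suc k)) ≡ x
SA-countBelow t {x} k x∈ rank-x
  with p , p∈ , refl ← ∈-map⁻ (suffix t) (subst (x ∈_) (sym (map-suffix-range1 t)) x∈) =
  countBelow-injective (suffixes t) (suffix-∈ t q∈) x∈
    (trans (sym (countBelow-suffixes t _)) (trans (≡ᵇ⇒≡ (rankSuf t q) k rank-q) (sym rank-x)))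
  where
  hasRank? = T? ∘ λ i → rankSuf t i ≡ᵇ k
  rank-p : rankSuf t p ≡ k
  rank-p = trans (countBelow-suffixes t _) rank-x
  q = SA t (suc k)
  q∈filter : q ∈ filter hasRank? (range1 (length t))
  q∈filter = firstOr0-∈ (∈-filter⁺ hasRank? p∈ (≡⇒≡ᵇ _ k rank-p))
  q∈ = proj₁ (∈-filter⁻ hasRank? {xs = range1 (length t)} q∈filter)
  rank-q = proj₂ (∈-filter⁻ hasRank? {xs = range1 (length t)} q∈filter)

-- Suffixes marked by an index

Marked : Str → ℕ → Str → Set
Marked u j x = Σ Str λ R → NoLeadingOne R × x ≡ u ++ ones j ++ R

marked-≺ : ∀ {u i j x y} → Marked u i x → Marked u j y → i < j → x ≺ y
marked-≺ {u} (R , R⊀ , refl) (R′ , _ , refl) i<j = subst T (sym (lexLt-++ˡ u _ _)) (ones-≺ i<j R⊀)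

marked-lcp : ∀ {u i j x y} → Marked u i x → Marked u j y → i < j → lcp y x ≡ length u + i
marked-lcp {u} (R , R⊀ , refl) (R′ , _ , refl) i<j =
  trans (lcp-++ˡ u _ _) (cong (length u +_) (lcp-ones i<j R⊀))

LCP-marked-++ : ∀ u t is₁ {i j is₂} →
  Pointwise (Marked u) (is₁ ++ i ∷ j ∷ is₂) (extending (u ∷ʳ true) (suffixes t)) →
  AllPairs _<_ (is₁ ++ i ∷ j ∷ is₂) →
  LCP t (countBelow (u ∷ʳ true) (suffixes t) + suc (length is₁) + 1) ≡ length u + i
LCP-marked-++ u t is₁ marks increasing
  with xs₁ , x ∷ y ∷ xs₂ , L≡ , marks₁ , mx ∷ my ∷ _ ← Pointwise-++⁻ is₁ marks
  with (i<j ∷ _) ∷ _ ← AllPairs-++⁻ʳ is₁ increasing = begin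
    LCP t (b + suc (length is₁) + 1)
  ≡⟨ cong (LCP t) index ⟩
    lcp (suffix t (SA t (suc (suc (b + k))))) (suffix t (SA t (suc (b + k))))
  ≡⟨ cong₂ lcp (SA-countBelow t (suc (b + k)) y∈ rank-y) (SA-countBelow t (b + k) x∈ rank-x) ⟩
    lcp y x
  ≡⟨ marked-lcp {u} mx my i<j ⟩
    length u + _
  ∎
  where
  open ≡-Reasoning
  w = u ∷ʳ true
  b = countBelow w (suffixes t)
  k = length xs₁
  sorted : AllPairs _≺_ (extending w (suffixes t))
  sorted = AllPairs-Pointwise (marked-≺ {u}) marks increasing
  index : b + suc (length is₁) + 1 ≡ suc (suc (b + k))
  index = trans (+-comm _ 1) (cong suc (trans (+-suc b _) (cong (suc ∘ (b +_)) (Pointwise-length marks₁))))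
  x∈ = proj₁ (countBelow-prefixed w (suffixes t) xs₁ sorted L≡)
  rank-x = proj₂ (countBelow-prefixed w (suffixes t) xs₁ sorted L≡)
  L≡′ : extending w (suffixes t) ≡ (xs₁ ∷ʳ x) ++ y ∷ xs₂
  L≡′ = trans L≡ (sym (++-assoc xs₁ (x ∷ []) (y ∷ xs₂)))
  y∈ = proj₁ (countBelow-prefixed w (suffixes t) (xs₁ ∷ʳ x) sorted L≡′)
  rank-y : countBelow y (suffixes t) ≡ suc (b + k)
  rank-y = trans (proj₂ (countBelow-prefixed w (suffixes t) (xs₁ ∷ʳ x) sorted L≡′))
                 (trans (cong (b +_) (trans (length-++ xs₁) (+-comm k 1))) (+-suc b k))

LCP-marked : ∀ u t {is} →
  Pointwise (Marked u) is (extending (u ∷ʳ true) (suffixes t)) → AllPairs _<_ is →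
  ∀ r → suc r < length is →
  LCP t (countBelow (u ∷ʳ true) (suffixes t) + suc r + 1) ≡ length u + at is (suc r)
LCP-marked u t {is} marks increasing r r<len =
  subst (λ k → LCP t (countBelow (u ∷ʳ true) (suffixes t) + suc k + 1) ≡ length u + at is (suc r))
        (trans (length-take r is) (m≤n⇒m⊓n≡m (<⇒≤ (<⇒≤ r<len))))
        (LCP-marked-++ u t (take r is) (subst (λ js → Pointwise _ js _) split marks)
                                       (subst (AllPairs _<_) split increasing))
  where split = at-split₂ is r r<len

-- Strings made of blocks 0^a 1^j

block : ℕ → ℕ → Str
block a j = zeros a ++ ones j

blocks : List (ℕ × ℕ) → Str
blocks ps = concat (map (uncurry block) ps)

PositiveBlock : ℕ × ℕ → Set
PositiveBlock (a , j) = 1 ≤ a × 1 ≤ j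

tallIndices : ℕ → List (ℕ × ℕ) → List ℕ
tallIndices v ps = map proj₂ (filterᵇ ((v ≤ᵇ_) ∘ proj₁) ps)

blocks-noLeadingOne : ∀ {ps} → All PositiveBlock ps → NoLeadingOne (blocks ps)
blocks-noLeadingOne []                  = tt
blocks-noLeadingOne ((s≤s z≤n , _) ∷ _) = tt

isPrefixOf-block : ∀ v a j R → isPrefixOf (zeros v ∷ʳ true) (block a (suc j) ++ R) ≡ (v ≡ᵇ a)
isPrefixOf-block zero    zero    j R = refl
isPrefixOf-block zero    (suc a) j R = refl
isPrefixOf-block (suc v) zero    j R = refl
isPrefixOf-block (suc v) (suc a) j R = isPrefixOf-block v a j R

prefixed-ones-suffixes : ∀ {v} → 1 ≤ v → ∀ j R →
  extending (zeros v ∷ʳ true) (map (_++ R) (suffixes (ones j))) ≡ []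
prefixed-ones-suffixes _         zero    R = refl
prefixed-ones-suffixes (s≤s z≤n) (suc j) R = prefixed-ones-suffixes (s≤s z≤n) j R

prefixed-block-suffixes-< : ∀ {v} → 1 ≤ v → ∀ a j R → a < v →
  extending (zeros v ∷ʳ true) (map (_++ R) (suffixes (block a (suc j)))) ≡ []
prefixed-block-suffixes-< 1≤v zero j R _ = prefixed-ones-suffixes 1≤v (suc j) R
prefixed-block-suffixes-< {v} 1≤v (suc a) j R a<v =
  trans (filter-reject (T? ∘ isPrefixOf (zeros v ∷ʳ true)) {xs = map (_++ R) (suffixes (block a (suc j)))}
          (>⇒≢ a<v ∘ ≡ᵇ⇒≡ v (suc a) ∘ subst T (isPrefixOf-block v (suc a) j R)))
        (prefixed-block-suffixes-< 1≤v a j R (<⇒≤ a<v))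

prefixed-block-suffixes-≥ : ∀ {v} → 1 ≤ v → ∀ a j R → v ≤ a →
  extending (zeros v ∷ʳ true) (map (_++ R) (suffixes (block a (suc j))))
    ≡ (zeros v ++ ones (suc j) ++ R) ∷ []
prefixed-block-suffixes-≥ (s≤s z≤n) zero j R ()
prefixed-block-suffixes-≥ {v} 1≤v (suc a) j R v≤a with m≤n⇒m<n∨m≡n v≤a
... | inj₁ v<a =
  trans (filter-reject (T? ∘ isPrefixOf (zeros v ∷ʳ true)) {xs = map (_++ R) (suffixes (block a (suc j)))}
          (>⇒≢ v<a ∘ sym ∘ ≡ᵇ⇒≡ v (suc a) ∘ subst T (isPrefixOf-block v (suc a) j R)))
        (prefixed-block-suffixes-≥ 1≤v a j R (≤-pred v<a))
... | inj₂ refl =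
  trans (filter-accept (T? ∘ isPrefixOf (zeros v ∷ʳ true)) {xs = map (_++ R) (suffixes (block a (suc j)))}
          (subst T (sym (isPrefixOf-block v v j R)) (≡⇒≡ᵇ v v refl)))
        (cong₂ _∷_ (++-assoc (zeros v) (ones (suc j)) R) (prefixed-block-suffixes-< 1≤v a j R (n<1+n a)))

blocks-suffixes-marked : ∀ {v} → 1 ≤ v → ∀ {ps} → All PositiveBlock ps →
  Pointwise (Marked (zeros v)) (tallIndices v ps) (extending (zeros v ∷ʳ true) (suffixes (blocks ps)))
blocks-suffixes-marked 1≤v [] = []
blocks-suffixes-marked {v} 1≤v {(a , suc j) ∷ ps} ((_ , s≤s z≤n) ∷ positive)
  rewrite suffixes-++ (block a (suc j)) (blocks ps)
        | filter-++ (T? ∘ isPrefixOf (zeros v ∷ʳ true))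
                    (map (_++ blocks ps) (suffixes (block a (suc j)))) (suffixes (blocks ps))
  with v ≤ᵇ a | ≤ᵇ-reflects-≤ v a
... | true  | ofʸ v≤a rewrite prefixed-block-suffixes-≥ 1≤v a j (blocks ps) v≤a =
  (blocks ps , blocks-noLeadingOne positive , refl) ∷ blocks-suffixes-marked 1≤v positive
... | false | ofⁿ v≰a rewrite prefixed-block-suffixes-< 1≤v a j (blocks ps) (≰⇒> v≰a) =
  blocks-suffixes-marked 1≤v positive

-- The final run 0^(n+1) 1^(n+1) of T is one more block, of height and index n + 1.
blockList : List ℕ → List (ℕ × ℕ)
blockList A = map (λ i → at A i , i) (range1 (length A)) ∷ʳ (suc (length A) , suc (length A))

buildT≡blocks : ∀ A → buildT A ≡ blocks (blockList A)
buildT≡blocks A = sym (begin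
    concat (map (uncurry block) (map heightAndIndex indices ∷ʳ fence))
  ≡⟨ cong concat (map-++ (uncurry block) (map heightAndIndex indices) (fence ∷ [])) ⟩
    concat (map (uncurry block) (map heightAndIndex indices) ∷ʳ uncurry block fence)
  ≡⟨ sym (concat-++ (map (uncurry block) (map heightAndIndex indices)) (uncurry block fence ∷ [])) ⟩
    concat (map (uncurry block) (map heightAndIndex indices)) ++ uncurry block fence ++ []
  ≡⟨ cong₂ _++_ (cong concat (sym (map-∘ indices))) (++-identityʳ (uncurry block fence)) ⟩
    buildT A
  ∎)
  where
  open ≡-Reasoning
  indices = range1 (length A)
  heightAndIndex = λ i → at A i , i
  fence = suc (length A) , suc (length A)

blockList-positive : ∀ A → A ↭ range1 (length A) → All PositiveBlock (blockList A)
blockList-positive A A↭ =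
  Allₚ.++⁺ (Allₚ.map⁺ (All.map (λ (1≤i , i≤n) → height-positive 1≤i i≤n , 1≤i)
                               (range1-bounds (length A))))
           ((s≤s z≤n , s≤s z≤n) ∷ [])
  where
  height-positive : ∀ {i} → 1 ≤ i → i ≤ length A → 1 ≤ at A i
  height-positive 1≤i i≤n =
    proj₁ (All.lookup (range1-bounds (length A)) (∈-resp-↭ A↭ (at-∈ A 1≤i i≤n)))

tallIndices-blockList : ∀ A v → v ≤ suc (length A) →
  tallIndices v (blockList A) ≡ filterᵇ (λ i → v ≤ᵇ at A i) (range1 (length A)) ∷ʳ suc (length A)
tallIndices-blockList A v v≤fence = begin
    map proj₂ (filterᵇ tall (map heightAndIndex indices ∷ʳ fence))
  ≡⟨ cong (map proj₂) (filter-++ (T? ∘ tall) (map heightAndIndex indices) (fence ∷ [])) ⟩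
    map proj₂ (filterᵇ tall (map heightAndIndex indices) ++ filterᵇ tall (fence ∷ []))
  ≡⟨ map-++ proj₂ (filterᵇ tall (map heightAndIndex indices)) _ ⟩
    map proj₂ (filterᵇ tall (map heightAndIndex indices)) ++ map proj₂ (filterᵇ tall (fence ∷ []))
  ≡⟨ cong₂ _++_ (cong (map proj₂) (filterᵇ-map tall heightAndIndex indices))
                (cong (map proj₂) (filter-accept (T? ∘ tall) {xs = []} (≤⇒≤ᵇ v≤fence))) ⟩
    map proj₂ (map heightAndIndex (filterᵇ (tall ∘ heightAndIndex) indices)) ∷ʳ suc (length A)
  ≡⟨ cong (_∷ʳ suc (length A)) (trans (sym (map-∘ (filterᵇ (tall ∘ heightAndIndex) indices)))
                                      (map-id _)) ⟩
    filterᵇ (λ i → v ≤ᵇ at A i) indices ∷ʳ suc (length A)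
  ∎
  where
  open ≡-Reasoning
  indices = range1 (length A)
  heightAndIndex = λ i → at A i , i
  fence = suc (length A) , suc (length A)
  tall = (v ≤ᵇ_) ∘ proj₁

filterᵇ-range1-∷ʳ-increasing : ∀ n (p : ℕ → Bool) → AllPairs _<_ (filterᵇ p (range1 n) ∷ʳ suc n)
filterᵇ-range1-∷ʳ-increasing n p =
  AllPairsₚ.++⁺ (AllPairsₚ.filter⁺ (T? ∘ p) (range1-increasing n)) ([] ∷ [])
                (All.map (λ i≤n → s≤s i≤n ∷ [])
                         (Allₚ.filter⁺ (T? ∘ p) (All.map proj₂ (range1-bounds n))))

lemma4p1 : (A : List ℕ) → 1 ≤ length A → A ↭ range1 (length A) →
    (v : ℕ) → 1 ≤ v → v ≤ length A →
    (r : ℕ) → 1 ≤ r → r ≤ count A (length A) v →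
    select A r v ≡ LCP (buildT A) (bOf (buildT A) v + r + 1) ∸ v
lemma4p1 A _ A↭ v 1≤v v≤n (suc r) (s≤s z≤n) r<count = begin
    select A (suc r) v
  ≡⟨ sym (m+n∸m≡n v _) ⟩
    v + select A (suc r) v ∸ v
  ≡⟨ cong (λ i → v + i ∸ v) (sym (at-++ˡ selected _ r r<count)) ⟩
    v + at indices (suc r) ∸ v
  ≡⟨ cong (_∸ v) (sym lcp≡) ⟩
    LCP t (bOf t v + suc r + 1) ∸ v
  ∎
  where
  open ≡-Reasoning
  t = buildT A
  selected = filterᵇ (λ i → v ≤ᵇ at A i) (range1 (length A))
  indices = selected ∷ʳ suc (length A)
  marks : Pointwise (Marked (zeros v)) indices (extending (zeros v ∷ʳ true) (suffixes t))
  marks = subst₂ (λ is t → Pointwise (Marked (zeros v)) is (extending (zeros v ∷ʳ true) (suffixes t)))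
                 (tallIndices-blockList A v (m≤n⇒m≤1+n v≤n)) (sym (buildT≡blocks A))
                 (blocks-suffixes-marked 1≤v (blockList-positive A A↭))
  r<len : suc r < length indices
  r<len = subst (suc r <_) (sym (trans (length-++ selected) (+-comm _ 1))) (s≤s r<count)
  lcp≡ : LCP t (bOf t v + suc r + 1) ≡ v + at indices (suc r)
  lcp≡ = trans (cong (λ b → LCP t (b + suc r + 1)) (countBelow-suffixes t (zeros v ∷ʳ true)))
               (trans (LCP-marked (zeros v) t marks (filterᵇ-range1-∷ʳ-increasing _ _) r r<len)
                      (cong (_+ at indices (suc r)) (length-replicate v)))
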